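{- Let $\pi=1\pi'\in S_n$, where $\pi'$ is a dominant permutation of $\{2,\dots,n\}$. Then the set of points $\{x_a-y_b : (a,b)\in \mathrm{Ess}(\pi)\}$ is the vertex set of a face of the polytope $$\Phi(\mathbb{P}(Y_\pi))=\mathrm{ConvHull}(x_i-y_j : (i,j)\in L(\pi)).$$
   Context: $x_1,\dots,x_n$ denote the standard basis of $\mathbb{R}^n\times 0$ and $y_1,\dots,y_n$ the standard basis of $0\times\mathbb{R}^n$ in $\mathbb{R}^{2n}$. Boxes in the $n\times n$ grid are indexed by (row, column), rows numbered from top to bottom. The diagram of $\pi$ is $D(\pi)=\{(\pi_j,i): i<j,\ \pi_i>\pi_j\}$. $\mathrm{Ess}(\pi)$ is the set of south-east corners of $D(\pi)$, i.e. the boxes $(a,b)\in D(\pi)$ with $(a+1,b),(a,b+1)\notin D(\pi)$. The dominant piece $\mathrm{dom}(\pi)$ is the edge-connected component of $D(\pi)$ containing $(1,1)$, or empty if $(1,1)\notin D(\pi)$. Let $NW(\pi)=\{(i,j): \exists (a,b)\in D(\pi),\ i\le a,\ j\le b\}$ and $L(\pi)=NW(\pi)\setminus\mathrm{dom}(\pi)$. The polytope $\Phi(\mathbb{P}(Y_\pi))$ is the moment polytope of the projectivization of $Y_\pi$, the projection of the matrix Schubert variety onto the coordinates in $L(\pi)$. $1\pi'$ denotes the permutation fixing $1$ and agreeing with $\pi'$ elsewhere. $\pi'$ is dominant if $D(1\pi')$ is empty or a Young diagram with northwest-most box $(2,2)$. -}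

module Defs where

open import Data.Nat using (ℕ; zero; suc; _≤_; _<_; _+_; _≡ᵇ_)
open import Data.Fin using (Fin; toℕ; splitAt)
import Data.Fin as F
open import Data.Fin.Permutation using (Permutation′; _⟨$⟩ʳ_)
open import Data.Product using (Σ; _×_; ∃-syntax)
open import Data.Sum using (inj₁; inj₂)
open import Data.Bool using (if_then_else_)
open import Relation.Nullary using (¬_)
open import Relation.Binary.PropositionalEquality using (_≡_)
open import Function.Bundles using (_⇔_)
open import Data.Rational as ℚ using (ℚ; 0ℚ; 1ℚ)

-- Conventions: everything is 0-indexed.  Row/column/value k (0-based)
-- corresponds to k+1 in the paper.  Boxes are pairs (row, column) of
-- natural numbers; boxes outside the n×n grid are never in D(π).

module _ {n : ℕ} (π : Permutation′ n) where

  πv : Fin n → ℕ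
  πv i = toℕ (π ⟨$⟩ʳ i)

  InD : ℕ → ℕ → Set
  InD a b = ∃[ i ] ∃[ j ] (toℕ i < toℕ j × πv j < πv i × πv j ≡ a × toℕ i ≡ b)

  Ess : ℕ → ℕ → Set
  Ess a b = InD a b × ¬ InD (suc a) b × ¬ InD a (suc b)

  data Adj : ℕ → ℕ → ℕ → ℕ → Set where
    down  : ∀ a b → Adj a b (suc a) b
    up    : ∀ a b → Adj (suc a) b a b
    right : ∀ a b → Adj a b a (suc b)
    left  : ∀ a b → Adj a (suc b) a b

  data Conn (a₀ b₀ : ℕ) : ℕ → ℕ → Set where
    here : InD a₀ b₀ → Conn a₀ b₀ a₀ b₀
    step : ∀ {a b a' b'} → Conn a₀ b₀ a b → Adj a b a' b' → InD a' b' →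
           Conn a₀ b₀ a' b'

  -- dom(π): the edge-connected component of D(π) containing the
  -- paper's box (1,1) (here (0,0)); empty if that box is not in D(π)
  Dom : ℕ → ℕ → Set
  Dom a b = Conn 0 0 a b

  NW : ℕ → ℕ → Set
  NW i j = ∃[ a ] ∃[ b ] (InD a b × i ≤ a × j ≤ b)

  L : ℕ → ℕ → Set
  L i j = NW i j × ¬ Dom i j

  -- π = 1π' : π fixes the paper's 1 (here 0)
  FixesFirst : Set
  FixesFirst = (z : Fin n) → toℕ z ≡ 0 → πv z ≡ 0

  -- D(1π') is empty or a Young diagram with northwest-most box
  -- the paper's (2,2) (here (1,1)): every box of D lies in rows/columns
  -- ≥ 1, and D is closed under moving north/west within that quadrant.
  -- (The empty set satisfies this vacuously; a nonempty such set
  -- contains (1,1).)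
  EmptyOrYoungAt22 : Set
  EmptyOrYoungAt22 = ∀ a b → InD a b →
    (1 ≤ a × 1 ≤ b × (∀ a' b' → 1 ≤ a' → a' ≤ a → 1 ≤ b' → b' ≤ b → InD a' b'))

-- The point x_a - y_b in ℚ^{2n}; coordinates Fin (n + n), the first n
-- being the x-coordinates and the last n the y-coordinates.
pt : (n : ℕ) → ℕ → ℕ → Fin (n + n) → ℚ
pt n a b k with splitAt n k
... | inj₁ i = if toℕ i ≡ᵇ a then 1ℚ else 0ℚ
... | inj₂ j = if toℕ j ≡ᵇ b then ℚ.- 1ℚ else 0ℚ

dot : (m : ℕ) → (Fin m → ℚ) → (Fin m → ℚ) → ℚ
dot zero    u v = 0ℚ
dot (suc m) u v = u F.zero ℚ.* v F.zero ℚ.+ dot m (λ k → u (F.suc k)) (λ k → v (F.suc k))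

-- {x_a - y_b : S a b} is the vertex set of a face of
-- ConvHull(x_i - y_j : Gen i j): there is a (rational) linear functional
-- c and level h such that c ≤ h on all generators, and a generator lies
-- on the hyperplane c = h iff it belongs to S; S consists of generators.
-- (All generators x_i - y_j are distinct vertices of the hull, so the
-- vertices of the face are exactly the generators on the hyperplane.)
IsFaceVertexSet : (n : ℕ) → (Gen S : ℕ → ℕ → Set) → Set
IsFaceVertexSet n Gen S =
  Σ (Fin (n + n) → ℚ) λ c → Σ ℚ λ h →
    (∀ a b → S a b → Gen a b) ×
    (∀ a b → Gen a b → dot (n + n) c (pt n a b) ℚ.≤ h) ×
    (∀ a b → Gen a b → (dot (n + n) c (pt n a b) ≡ h ⇔ S a b))

{-# OPTIONS --safe #-}
-- D(π) is a Young diagram away from row and column 1, so dom(π) is empty and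
-- L(π) = NW(π) = D(π).  In a Young diagram each column b contains at most one
-- essential box, at the bottom row r(b) of that column (set r(b) := n if there
-- is none).  The functional sending x_a ↦ a and y_b ↦ r(b) takes the value
-- a - r(b) ≤ 0 at x_a - y_b for (a, b) ∈ L(π), with equality exactly at the
-- essential boxes.
module Submission where

open import Defs
open import Data.Nat as ℕ using (ℕ; zero; suc; _≤_; _<_; _+_; _≡ᵇ_; z≤n; s≤s)
import Data.Nat.Properties as ℕ
open import Data.Fin as Fin using (Fin; toℕ; splitAt)
import Data.Fin.Properties as Fin
open import Data.Fin.Permutation using (Permutation′; _⟨$⟩ʳ_)
open import Data.Vec.Functional using (Vector; _++_)
open import Data.Product using (_×_; _,_; proj₁; proj₂; ∃)
open import Data.Sum using (inj₁; inj₂)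
open import Data.Bool using (if_then_else_)
open import Data.Empty using (⊥-elim)
open import Relation.Nullary using (¬_; Dec; yes; no; contradiction)
open import Relation.Nullary.Decidable using (_×-dec_; ¬?)
open import Relation.Binary.Definitions using (tri<; tri≈; tri>)
open import Relation.Binary.PropositionalEquality
open import Function using (_∘_)
open import Function.Bundles using (_⇔_; mk⇔)
import Function.Properties.Equivalence as ⇔
open import Data.Rational as ℚ using (ℚ; 0ℚ; 1ℚ; _-_)
import Data.Rational.Properties as ℚ
open import Algebra.Properties.Group ℚ.+-0-group using (x∙y⁻¹≈ε⇒x≈y; x≈y⇒x∙y⁻¹≈ε)

fromℕ : ℕ → ℚ
fromℕ zero    = 0ℚ
fromℕ (suc m) = fromℕ m ℚ.+ 1ℚ

fromℕ-<-suc : ∀ m → fromℕ m ℚ.< fromℕ (suc m)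
fromℕ-<-suc m = subst (ℚ._< fromℕ (suc m)) (ℚ.+-identityʳ (fromℕ m))
  (ℚ.+-monoʳ-< (fromℕ m) (ℚ.positive⁻¹ 1ℚ))

fromℕ-mono-< : ∀ {m k} → m < k → fromℕ m ℚ.< fromℕ k
fromℕ-mono-< {m} {suc k} (s≤s m≤k) with ℕ.m≤n⇒m<n∨m≡n m≤k
... | inj₁ m<k  = ℚ.<-trans (fromℕ-mono-< m<k) (fromℕ-<-suc k)
... | inj₂ refl = fromℕ-<-suc m

fromℕ-mono-≤ : ∀ {m k} → m ≤ k → fromℕ m ℚ.≤ fromℕ k
fromℕ-mono-≤ m≤k with ℕ.m≤n⇒m<n∨m≡n m≤k
... | inj₁ m<k  = ℚ.<⇒≤ (fromℕ-mono-< m<k)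
... | inj₂ refl = ℚ.≤-refl

fromℕ-injective : ∀ {m k} → fromℕ m ≡ fromℕ k → m ≡ k
fromℕ-injective {m} {k} eq with ℕ.<-cmp m k
... | tri< m<k _ _ = contradiction eq (ℚ.<⇒≢ (fromℕ-mono-< m<k))
... | tri≈ _ m≡k _ = m≡k
... | tri> _ _ k<m = contradiction (sym eq) (ℚ.<⇒≢ (fromℕ-mono-< k<m))

p≤q⇒p-q≤0 : ∀ {p q} → p ℚ.≤ q → p - q ℚ.≤ 0ℚ
p≤q⇒p-q≤0 {p} {q} p≤q = subst (p - q ℚ.≤_) (ℚ.+-inverseʳ q) (ℚ.+-monoˡ-≤ (ℚ.- q) p≤q)

p-q≡0⇔p≡q : ∀ {p q} → (p - q ≡ 0ℚ) ⇔ (p ≡ q)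
p-q≡0⇔p≡q {p} {q} = mk⇔ (x∙y⁻¹≈ε⇒x≈y p q) x≈y⇒x∙y⁻¹≈ε

dot-cong : ∀ m {u u′ v v′ : Vector ℚ m} → u ≗ u′ → v ≗ v′ → dot m u v ≡ dot m u′ v′
dot-cong zero    u≗u′ v≗v′ = refl
dot-cong (suc m) u≗u′ v≗v′ = cong₂ ℚ._+_ (cong₂ ℚ._*_ (u≗u′ Fin.zero) (v≗v′ Fin.zero))
  (dot-cong m (u≗u′ ∘ Fin.suc) (v≗v′ ∘ Fin.suc))

dot-zeroʳ : ∀ m (u : Vector ℚ m) → dot m u (λ _ → 0ℚ) ≡ 0ℚ
dot-zeroʳ zero    u = refl
dot-zeroʳ (suc m) u = begin
  u Fin.zero ℚ.* 0ℚ ℚ.+ dot m (u ∘ Fin.suc) (λ _ → 0ℚ)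
    ≡⟨ cong₂ ℚ._+_ (ℚ.*-zeroʳ (u Fin.zero)) (dot-zeroʳ m (u ∘ Fin.suc)) ⟩
  0ℚ ℚ.+ 0ℚ
    ≡⟨ ℚ.+-identityʳ 0ℚ ⟩
  0ℚ ∎
  where open ≡-Reasoning

++-suc : ∀ {m k} (u : Vector ℚ (suc m)) (u′ : Vector ℚ k) →
  (u ++ u′) ∘ Fin.suc ≗ (u ∘ Fin.suc) ++ u′
++-suc {m} u u′ i with splitAt m i
... | inj₁ _ = refl
... | inj₂ _ = refl

dot-++ : ∀ m {k} (u v : Vector ℚ m) (u′ v′ : Vector ℚ k) →
  dot (m + k) (u ++ u′) (v ++ v′) ≡ dot m u v ℚ.+ dot k u′ v′
dot-++ zero    u v u′ v′ = sym (ℚ.+-identityˡ _)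
dot-++ (suc m) u v u′ v′ = begin
  u₀v₀ ℚ.+ dot (m + _) ((u ++ u′) ∘ Fin.suc) ((v ++ v′) ∘ Fin.suc)
    ≡⟨ cong (u₀v₀ ℚ.+_) (dot-cong (m + _) (++-suc u u′) (++-suc v v′)) ⟩
  u₀v₀ ℚ.+ dot (m + _) ((u ∘ Fin.suc) ++ u′) ((v ∘ Fin.suc) ++ v′)
    ≡⟨ cong (u₀v₀ ℚ.+_) (dot-++ m (u ∘ Fin.suc) (v ∘ Fin.suc) u′ v′) ⟩
  u₀v₀ ℚ.+ (dot m (u ∘ Fin.suc) (v ∘ Fin.suc) ℚ.+ dot _ u′ v′)
    ≡⟨ ℚ.+-assoc u₀v₀ _ _ ⟨
  (u₀v₀ ℚ.+ dot m (u ∘ Fin.suc) (v ∘ Fin.suc)) ℚ.+ dot _ u′ v′ ∎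
  where
  open ≡-Reasoning
  u₀v₀ : ℚ
  u₀v₀ = u Fin.zero ℚ.* v Fin.zero

δ : ∀ {m} → ℕ → ℚ → Vector ℚ m
δ a s i = if toℕ i ≡ᵇ a then s else 0ℚ

dot-δ : ∀ m (f : ℕ → ℚ) {a} s → a < m → dot m (f ∘ toℕ) (δ a s) ≡ f a ℚ.* s
dot-δ (suc m) f {zero} s _ =
  trans (cong (f 0 ℚ.* s ℚ.+_) (dot-zeroʳ m (f ∘ suc ∘ toℕ))) (ℚ.+-identityʳ _)
dot-δ (suc m) f {suc a} s (s≤s a<m) =
  trans (cong₂ ℚ._+_ (ℚ.*-zeroʳ (f 0)) (dot-δ m (f ∘ suc) s a<m)) (ℚ.+-identityˡ _)

pt≗δ++δ : ∀ n a b → pt n a b ≗ δ {n} a 1ℚ ++ δ {n} b (ℚ.- 1ℚ)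
pt≗δ++δ n a b k with splitAt n k
... | inj₁ _ = refl
... | inj₂ _ = refl

functional : ∀ n → (ℕ → ℚ) → (ℕ → ℚ) → Vector ℚ (n + n)
functional n f g = _++_ {m = n} (f ∘ toℕ) (g ∘ toℕ)

dot-pt : ∀ n (f g : ℕ → ℚ) {a b} → a < n → b < n →
  dot (n + n) (functional n f g) (pt n a b) ≡ f a - g b
dot-pt n f g {a} {b} a<n b<n = begin
  dot (n + n) (functional n f g) (pt n a b)
    ≡⟨ dot-cong (n + n) (λ _ → refl) (pt≗δ++δ n a b) ⟩
  dot (n + n) (functional n f g) (δ {n} a 1ℚ ++ δ {n} b (ℚ.- 1ℚ))
    ≡⟨ dot-++ n (f ∘ toℕ) (δ a 1ℚ) (g ∘ toℕ) (δ b (ℚ.- 1ℚ)) ⟩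
  dot n (f ∘ toℕ) (δ a 1ℚ) ℚ.+ dot n (g ∘ toℕ) (δ b (ℚ.- 1ℚ))
    ≡⟨ cong₂ ℚ._+_ (dot-δ n f 1ℚ a<n) (dot-δ n g (ℚ.- 1ℚ) b<n) ⟩
  f a ℚ.* 1ℚ ℚ.+ g b ℚ.* (ℚ.- 1ℚ)
    ≡⟨ cong₂ ℚ._+_ (ℚ.*-identityʳ (f a)) (sym (ℚ.neg-distribʳ-* (g b) 1ℚ)) ⟩
  f a ℚ.+ ℚ.- (g b ℚ.* 1ℚ)
    ≡⟨ cong (λ x → f a - x) (ℚ.*-identityʳ (g b)) ⟩
  f a - g b ∎
  where open ≡-Reasoning

module _ {n : ℕ} (π : Permutation′ n) where

  InD? : ∀ a b → Dec (InD π a b)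
  InD? a b = Fin.any? λ i → Fin.any? λ j →
    (toℕ i ℕ.<? toℕ j) ×-dec (πv π j ℕ.<? πv π i) ×-dec (πv π j ℕ.≟ a) ×-dec (toℕ i ℕ.≟ b)

  Ess? : ∀ a b → Dec (Ess π a b)
  Ess? a b = InD? a b ×-dec ¬? (InD? (suc a) b) ×-dec ¬? (InD? a (suc b))

  InD⇒<n : ∀ {a b} → InD π a b → a < n × b < n
  InD⇒<n (i , j , _ , _ , refl , refl) = Fin.toℕ<n (π ⟨$⟩ʳ j) , Fin.toℕ<n i

  NW⇒<n : ∀ {a b} → NW π a b → a < n × b < n
  NW⇒<n (_ , _ , d , a≤ , b≤) with InD⇒<n d
  ... | a′<n , b′<n = ℕ.≤-<-trans a≤ a′<n , ℕ.≤-<-trans b≤ b′<n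

  Ess⇒NW : ∀ {a b} → Ess π a b → NW π a b
  Ess⇒NW {a} {b} (d , _) = a , b , d , ℕ.≤-refl , ℕ.≤-refl

  Conn⇒InD-root : ∀ {a₀ b₀ a b} → Conn π a₀ b₀ a b → InD π a₀ b₀
  Conn⇒InD-root (here d)     = d
  Conn⇒InD-root (step c _ _) = Conn⇒InD-root c

module YoungDiagram {n : ℕ} (π : Permutation′ n) (young : EmptyOrYoungAt22 π) where

  Dom-empty : ∀ {a b} → ¬ Dom π a b
  Dom-empty c with proj₁ (young 0 0 (Conn⇒InD-root π c))
  ... | ()

  -- If a > a′, the box (a′ + 1, b) lies north-west of a box of D(π), hence in D(π).
  NW⇒≤Ess-row : ∀ {a b a′} → NW π a b → Ess π a′ b → a ≤ a′
  NW⇒≤Ess-row {a} {b} {a′} (a₂ , b₂ , d₂ , a≤a₂ , b≤b₂) (e , ¬below , _) with a ℕ.≤? a′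
  ... | yes a≤a′ = a≤a′
  ... | no  a≰a′ = contradiction
    (proj₂ (proj₂ (young a₂ b₂ d₂)) (suc a′) b (s≤s z≤n) (ℕ.≤-trans (ℕ.≰⇒> a≰a′) a≤a₂)
      (proj₁ (proj₂ (young a′ b e))) b≤b₂)
    ¬below

  Ess-row-unique : ∀ {a a′ b} → Ess π a b → Ess π a′ b → a ≡ a′
  Ess-row-unique e e′ = ℕ.≤-antisym (NW⇒≤Ess-row (Ess⇒NW π e) e′) (NW⇒≤Ess-row (Ess⇒NW π e′) e)

  hasEss? : ∀ b → Dec (∃ λ (a : Fin n) → Ess π (toℕ a) b)
  hasEss? b = Fin.any? (λ a → Ess? π (toℕ a) b)

  essRow : ℕ → ℕ
  essRow b with hasEss? b
  ... | yes (a , _) = toℕ a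
  ... | no _        = n

  NW⇒≤essRow : ∀ {a b} → NW π a b → a ≤ essRow b
  NW⇒≤essRow {a} {b} nw with hasEss? b
  ... | yes (_ , e) = NW⇒≤Ess-row nw e
  ... | no _        = ℕ.<⇒≤ (proj₁ (NW⇒<n π nw))

  NW⇒[≡essRow⇔Ess] : ∀ {a b} → NW π a b → (a ≡ essRow b) ⇔ Ess π a b
  NW⇒[≡essRow⇔Ess] {a} {b} nw with hasEss? b
  ... | yes (a′ , e) = mk⇔ (λ { refl → e }) (λ e′ → Ess-row-unique e′ e)
  ... | no ¬e = mk⇔ (λ a≡n → contradiction a≡n (ℕ.<⇒≢ a<n))
                    (λ e′ → ⊥-elim (¬e (Fin.fromℕ< a<n ,
                      subst (λ x → Ess π x b) (sym (Fin.toℕ-fromℕ< a<n)) e′)))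
    where
    a<n : a < n
    a<n = proj₁ (NW⇒<n π nw)

mainTheorem8 : (n : ℕ) (π : Permutation′ n) → FixesFirst π → EmptyOrYoungAt22 π →
    IsFaceVertexSet n (L π) (Ess π)
mainTheorem8 n π _ young = c , 0ℚ , Ess⊆L , L⇒c≤0 , L⇒[c≡0⇔Ess]
  where
  open YoungDiagram π young

  c : Vector ℚ (n + n)
  c = functional n fromℕ (fromℕ ∘ essRow)

  c-at : ∀ {a b} → NW π a b → dot (n + n) c (pt n a b) ≡ fromℕ a - fromℕ (essRow b)
  c-at nw = dot-pt n fromℕ (fromℕ ∘ essRow) (proj₁ (NW⇒<n π nw)) (proj₂ (NW⇒<n π nw))

  Ess⊆L : ∀ a b → Ess π a b → L π a b
  Ess⊆L a b e = Ess⇒NW π e , Dom-empty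

  L⇒c≤0 : ∀ a b → L π a b → dot (n + n) c (pt n a b) ℚ.≤ 0ℚ
  L⇒c≤0 a b (nw , _) rewrite c-at nw = p≤q⇒p-q≤0 (fromℕ-mono-≤ (NW⇒≤essRow nw))

  L⇒[c≡0⇔Ess] : ∀ a b → L π a b → (dot (n + n) c (pt n a b) ≡ 0ℚ) ⇔ Ess π a b
  L⇒[c≡0⇔Ess] a b (nw , _) rewrite c-at nw =
    ⇔.trans p-q≡0⇔p≡q (⇔.trans (mk⇔ fromℕ-injective (cong fromℕ)) (NW⇒[≡essRow⇔Ess] nw))
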